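{- Let $k \geq 2$ be an integer, let $\ell := \lfloor \log_2 k \rfloor$, and let $p_1 < \cdots < p_\ell$ be $\ell$ pairwise distinct prime numbers. Then there exists a partition of $\mathbb{N}$ into $k$ sets $A_1, \ldots, A_k$ such that, for each $i = 1, \ldots, \ell$, none of $R(A_1), \ldots, R(A_k)$ is dense in $\mathbb{Q}_{p_i}$.
   Context: $\mathbb{N}$ denotes the set of positive integers. For $A \subseteq \mathbb{N}$, $R(A) := \{a/b : a, b \in A\}$, viewed as a subset of $\mathbb{Q}_p$ with the $p$-adic topology. $\lfloor x \rfloor$ is the greatest integer not exceeding $x$ and $\log_2$ is the base-$2$ logarithm. -}

module Defs where

open import Data.Nat using (ℕ; suc; _^_)
open import Data.Nat.Divisibility using (_∣_)
open import Data.Integer using (+_; ∣_∣)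
open import Data.Rational using (ℚ; _/_; _-_)
open import Data.Fin using (Fin)
open import Data.Product using (Σ; ∃; _×_)
open import Relation.Nullary using (¬_)
open import Relation.Binary.PropositionalEquality using (_≡_)

-- v_p(z) ≥ m for a rational z (m ≥ 0), using that ℚ is stored in lowest terms:
-- z = n/d reduced; v_p(z) ≥ m  iff  p^m ∣ n  and  p ∤ d.  (z = 0 counts as v_p = ∞.)
ValAtLeast : ℕ → ℕ → ℚ → Set
ValAtLeast p m z = (p ^ m ∣ ∣ ℚ.numerator z ∣) × ¬ (p ∣ ℚ.denominatorℕ z)

-- S ⊆ ℚ is dense in ℚ_p.  Since ℚ is dense in ℚ_p and the balls x + p^m ℤ_p
-- (m ∈ ℕ) form a neighbourhood base at x, this is: every p-adic ball around
-- every rational point meets S.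
DenseIn : ℕ → (ℚ → Set) → Set
DenseIn p S = (x : ℚ) (m : ℕ) → Σ ℚ λ s → S s × ValAtLeast p m (s - x)

-- A partition of the positive integers into k sets A_1..A_k is encoded as a
-- colouring c : ℕ → Fin k, where the positive integer n belongs to A_j iff
-- c n ≡ j (the value c 0 is irrelevant since 0 ∉ ℕ in the paper).
RatioSet : ∀ {k} → (ℕ → Fin k) → Fin k → ℚ → Set
RatioSet c j s = ∃ λ a → ∃ λ b →
  c (suc a) ≡ j × c (suc b) ≡ j × s ≡ (+ suc a) / suc b

{-# OPTIONS --safe #-}
module Submission where

-- Colour n by the parity pattern of (ν_{p_i}(n))_i, one of 2^ℓ ≤ k patterns, and
-- spread each pattern over the colours congruent to it mod 2^ℓ by ⌊ν_{p_1}(n)/2⌋,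
-- which does not change the pattern. Since the p_i are distinct primes, the
-- numbers ∏ p_i^{e_i} have prescribed valuations, so every colour is used. If a/b
-- lies in the ball p_i + p_i²ℤ_{p_i}, then ν_{p_i}(a/b) = 1, so ν_{p_i}(a) and
-- ν_{p_i}(b) have different parities and a, b get different colours: that ball
-- misses every R(A_j).

open import Defs
open import Data.Nat using (ℕ; suc; _≤_; _<_)
open import Data.Nat.Logarithm using (⌊log₂_⌋)
open import Data.Nat.Primality using (Prime)
open import Data.Fin using (Fin) renaming (_<_ to _<ᶠ_)
open import Data.Product using (Σ; ∃; _×_)
open import Relation.Nullary using (¬_)
open import Relation.Binary.PropositionalEquality using (_≡_)

open import Data.Fin using (zero; suc; toℕ; fromℕ<; inject≤; funToFin; finToFun; combine)
open import Data.Fin.Properties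
  using (punchInᵢ≢i; toℕ-injective; toℕ-fromℕ<; toℕ-inject≤; toℕ<n; funToFin-finToFin; finToFun-funToFin)
import Data.Fin.Properties as Fin
open import Data.Integer as ℤ using (+_)
open import Data.Integer.GCD using (gcd)
import Data.Integer.Divisibility.Signed as ℤ∣
import Data.Integer.Properties as ℤ
open import Data.Integer.Tactic.RingSolver using (solve-∀)
open import Data.Nat.Base
  using (zero; _+_; _*_; _^_; pred; ⌊_/2⌋; ⌈_/2⌉; NonZero; NonTrivial; ≢-nonZero; ≢-nonZero⁻¹; >-nonZero;
         nonTrivial⇒nonZero; nonTrivial⇒n>1; z<s; s≤s⁻¹; *-1-rawMonoid)
open import Data.Nat.Properties
open import Data.Nat.Divisibility
  using (_∣_; _∣?_; quotient; quotient≢0; quotient-<; m∣n⇒n≡m*quotient; m∣m*n; n∣m*n; ∣-trans; >⇒∤; _∣0)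
open import Data.Nat.DivMod
  using (_/_; _mod_; [m+kn]%n≡m%n; m<n⇒m%n≡m; m≡m%n+[m/n]*n; +-distrib-/-∣ʳ; m<n⇒m/n≡0; m*n/n≡m)
open import Data.Nat.Induction using (<-wellFounded)
open import Data.Nat.Logarithm using (⌊log₂⌋-mono-≤)
open import Data.Nat.Logarithm.Core using (⌊log2⌋)
open import Data.Nat.Primality using (¬prime[1]; prime⇒nonZero; prime⇒nonTrivial; euclidsLemma; prime⇒irreducible)
open import Data.Product using (_,_)
import Data.Rational as ℚ
open import Data.Rational using (mkℚ; ↥_; ↧_; ↧ₙ_)
open import Data.Rational.Literals using (fromℤ)
import Data.Rational.Properties as ℚ
import Data.Rational.Unnormalised.Properties as ℚᵘ
open import Data.Sum using (inj₁; inj₂; [_,_]′)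
open import Data.Vec.Functional using (Vector; removeAt)
open import Function using (_∘_)
open import Function.Definitions using (Injective)
open import Induction.WellFounded using (Acc; acc)
open import Relation.Binary.Definitions using (tri<; tri≈; tri>)
open import Relation.Binary.PropositionalEquality
  using (_≢_; _≗_; refl; sym; trans; cong; cong₂; subst; module ≡-Reasoning)
open import Relation.Nullary using (yes; no; contradiction)

open import Algebra.Definitions.RawMonoid *-1-rawMonoid using () renaming (sum to product)
open import Algebra.Properties.CommutativeMonoid.Sum +-0-commutativeMonoid
  using (sum; sum-remove; sum-cong-≗; sum-replicate-zero)
open import Algebra.Properties.CommutativeSemigroup *-commutativeSemigroup using (interchange)
open import Algebra.Properties.CommutativeSemigroup ℤ.*-commutativeSemigroup using (xy∙z≈xz∙y)
open import Algebra.Properties.Group ℚ.+-0-group using (//-rightDividesˡ)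

record ExactPower (p e n : ℕ) : Set where
  constructor exactPower
  field
    cofactor   : ℕ
    equality   : n ≡ p ^ e * cofactor
    p∤cofactor : ¬ p ∣ cofactor

-- The fuel n suffices since each division by p strictly decreases n.
ν-fuel : ℕ → ℕ → ℕ → ℕ
ν-fuel p zero       n = 0
ν-fuel p (suc fuel) n with p ∣? n
... | yes p∣n = suc (ν-fuel p fuel (quotient p∣n))
... | no  _   = 0

ν : ℕ → ℕ → ℕ
ν p n = ν-fuel p n n

module _ {p : ℕ} .{{_ : NonTrivial p}} where

  indivisible-exact : ∀ {n} → ¬ p ∣ n → ExactPower p 0 n
  indivisible-exact {n} p∤n = exactPower n (sym (*-identityˡ n)) p∤n

  exact-p* : ∀ {e m n} → n ≡ p * m → ExactPower p e m → ExactPower p (suc e) n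
  exact-p* {e} refl (exactPower u refl p∤u) = exactPower u (sym (*-assoc p (p ^ e) u)) p∤u

  ν-fuel-exact : ∀ fuel n .{{_ : NonZero n}} → n ≤ fuel → ExactPower p (ν-fuel p fuel n) n
  ν-fuel-exact zero       n n≤0 = contradiction (n≤0⇒n≡0 n≤0) (≢-nonZero⁻¹ n)
  ν-fuel-exact (suc fuel) n n≤fuel with p ∣? n
  ... | no  p∤n = indivisible-exact p∤n
  ... | yes p∣n = exact-p* (m∣n⇒n≡m*quotient p∣n)
    (ν-fuel-exact fuel (quotient p∣n) {{quotient≢0 p∣n}}
      (s≤s⁻¹ (<-≤-trans (quotient-< p∣n) n≤fuel)))

  ν-exact : ∀ n .{{_ : NonZero n}} → ExactPower p (ν p n) n
  ν-exact n = ν-fuel-exact n n ≤-refl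

  p∣p^[1+e]*u : ∀ e u → p ∣ p ^ suc e * u
  p∣p^[1+e]*u e u = ∣-trans (m∣m*n (p ^ e)) (m∣m*n u)

  exact-unique : ∀ {e f n} → ExactPower p e n → ExactPower p f n → e ≡ f
  exact-unique {zero}  {zero}  _ _ = refl
  exact-unique {zero}  {suc f} (exactPower u refl p∤u) (exactPower w eq _) =
    contradiction (subst (p ∣_) (trans (sym eq) (*-identityˡ u)) (p∣p^[1+e]*u f w)) p∤u
  exact-unique {suc e} {zero}  (exactPower u eq _) (exactPower w refl p∤w) =
    contradiction (subst (p ∣_) (trans (sym eq) (*-identityˡ w)) (p∣p^[1+e]*u e u)) p∤w
  exact-unique {suc e} {suc f} (exactPower u refl p∤u) (exactPower w eq p∤w) =
    cong suc (exact-unique (exactPower u refl p∤u) (exactPower w p^e*u≡p^f*w p∤w))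
    where
    p^e*u≡p^f*w : p ^ e * u ≡ p ^ f * w
    p^e*u≡p^f*w = *-cancelˡ-≡ _ _ p {{nonTrivial⇒nonZero p}}
      (trans (sym (*-assoc p _ u)) (trans eq (*-assoc p _ w)))

  exact⇒nonZero : ∀ {e n} → ExactPower p e n → NonZero n
  exact⇒nonZero {e} (exactPower u refl p∤u) =
    m*n≢0 (p ^ e) u {{m^n≢0 p e {{nonTrivial⇒nonZero p}}}} {{≢-nonZero λ { refl → p∤u (p ∣0) }}}

  ν-unique : ∀ {e n} → ExactPower p e n → ν p n ≡ e
  ν-unique {n = n} x = exact-unique (ν-exact n {{exact⇒nonZero x}}) x

  p^e-exact : ∀ e → ExactPower p e (p ^ e)
  p^e-exact e = exactPower 1 (sym (*-identityʳ _)) (>⇒∤ (nonTrivial⇒n>1 p))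

  ν-indivisible : ∀ {n} → ¬ p ∣ n → ν p n ≡ 0
  ν-indivisible = ν-unique ∘ indivisible-exact

  ν-p^e : ∀ e → ν p (p ^ e) ≡ e
  ν-p^e = ν-unique ∘ p^e-exact

product≢0 : ∀ {n} (f : Vector ℕ n) → (∀ i → NonZero (f i)) → NonZero (product f)
product≢0 {zero}  f f≢0 = _
product≢0 {suc n} f f≢0 = m*n≢0 (f zero) _ {{f≢0 zero}} {{product≢0 (f ∘ suc) (f≢0 ∘ suc)}}

module _ {p : ℕ} (p-prime : Prime p) where
  open ≡-Reasoning
  private instance
    p-nonTrivial : NonTrivial p
    p-nonTrivial = prime⇒nonTrivial p-prime

  exact-* : ∀ {e f m n} → ExactPower p e m → ExactPower p f n → ExactPower p (e + f) (m * n)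
  exact-* {e} {f} (exactPower u refl p∤u) (exactPower w refl p∤w) =
    exactPower (u * w) p^e*u*[p^f*w]≡p^[e+f]*[u*w] ([ p∤u , p∤w ]′ ∘ euclidsLemma u w p-prime)
    where
    p^e*u*[p^f*w]≡p^[e+f]*[u*w] : p ^ e * u * (p ^ f * w) ≡ p ^ (e + f) * (u * w)
    p^e*u*[p^f*w]≡p^[e+f]*[u*w] =
      trans (interchange (p ^ e) u (p ^ f) w) (cong (_* (u * w)) (sym (^-distribˡ-+-* p e f)))

  ν-* : ∀ m n .{{_ : NonZero m}} .{{_ : NonZero n}} → ν p (m * n) ≡ ν p m + ν p n
  ν-* m n = ν-unique (exact-* (ν-exact m) (ν-exact n))

  ν-cross : ∀ {a b d y} .{{_ : NonZero a}} .{{_ : NonZero b}} →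
            a * d ≡ p * y * b → ¬ p ∣ d → ¬ p ∣ y → ν p a ≡ suc (ν p b)
  ν-cross {a} {b} {d} {y} a*d≡p*y*b p∤d p∤y = begin
    ν p a             ≡⟨ +-identityʳ (ν p a) ⟨
    ν p a + 0         ≡⟨ ν-unique (exact-* (ν-exact a) (indivisible-exact p∤d)) ⟨
    ν p (a * d)       ≡⟨ cong (ν p) a*d≡p*y*b ⟩
    ν p (p * y * b)   ≡⟨ ν-unique p^[1+ν[b]]∥p*y*b ⟩
    suc (ν p b)       ∎
    where
    p^[1+ν[b]]∥p*y*b : ExactPower p (suc (ν p b)) (p * y * b)
    p^[1+ν[b]]∥p*y*b = exact-p* (*-assoc p y b) (exact-* (indivisible-exact p∤y) (ν-exact b))

  ν-product : ∀ {n} (f : Vector ℕ n) → (∀ i → NonZero (f i)) → ν p (product f) ≡ sum (ν p ∘ f)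
  ν-product {zero}  f f≢0 = ν-indivisible (>⇒∤ (nonTrivial⇒n>1 p))
  ν-product {suc n} f f≢0 = begin
    ν p (f zero * product (f ∘ suc))        ≡⟨ ν-* (f zero) _ {{f≢0 zero}} {{product≢0 (f ∘ suc) (f≢0 ∘ suc)}} ⟩
    ν p (f zero) + ν p (product (f ∘ suc))  ≡⟨ cong (_+_ (ν p (f zero))) (ν-product (f ∘ suc) (f≢0 ∘ suc)) ⟩
    ν p (f zero) + sum (ν p ∘ f ∘ suc)      ∎

prime∤prime^ : ∀ {p q} → Prime p → Prime q → p ≢ q → ∀ b → ¬ p ∣ q ^ b
prime∤prime^ p-prime q-prime p≢q zero    = >⇒∤ (nonTrivial⇒n>1 _ {{prime⇒nonTrivial p-prime}})
prime∤prime^ p-prime q-prime p≢q (suc b) p∣q*q^b with euclidsLemma _ _ p-prime p∣q*q^b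
... | inj₂ p∣q^b = prime∤prime^ p-prime q-prime p≢q b p∣q^b
... | inj₁ p∣q with prime⇒irreducible q-prime p∣q
...   | inj₁ refl = contradiction p-prime ¬prime[1]
...   | inj₂ p≡q  = p≢q p≡q

sum-single : ∀ {n} (t : Vector ℕ n) i → (∀ j → j ≢ i → t j ≡ 0) → sum t ≡ t i
sum-single {suc n} t i t≡0 = begin
  sum t                     ≡⟨ sum-remove t ⟩
  t i + sum (removeAt t i)  ≡⟨ cong (_+_ (t i)) sum-rest≡0 ⟩
  t i + 0                   ≡⟨ +-identityʳ (t i) ⟩
  t i                       ∎
  where
  open ≡-Reasoning
  sum-rest≡0 : sum (removeAt t i) ≡ 0
  sum-rest≡0 = trans (sum-cong-≗ (λ j → t≡0 _ (punchInᵢ≢i i j))) (sum-replicate-zero n)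

ν-product-of-powers : ∀ {n} {q : Vector ℕ n} → (∀ i → Prime (q i)) → Injective _≡_ _≡_ q →
                      ∀ (e : Vector ℕ n) m → ν (q m) (product (λ i → q i ^ e i)) ≡ e m
ν-product-of-powers {q = q} q-prime q-injective e m = begin
  ν (q m) (product q^e)       ≡⟨ ν-product (q-prime m) q^e q^e≢0 ⟩
  sum (λ i → ν (q m) (q^e i)) ≡⟨ sum-single (λ i → ν (q m) (q^e i)) m ν[q^e]≡0 ⟩
  ν (q m) (q^e m)             ≡⟨ ν-p^e {{prime⇒nonTrivial (q-prime m)}} (e m) ⟩
  e m                         ∎
  where
  open ≡-Reasoning
  q^e : Vector ℕ _
  q^e i = q i ^ e i
  q^e≢0 : ∀ i → NonZero (q^e i)
  q^e≢0 i = m^n≢0 (q i) (e i) {{prime⇒nonZero (q-prime i)}}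
  ν[q^e]≡0 : ∀ i → i ≢ m → ν (q m) (q^e i) ≡ 0
  ν[q^e]≡0 i i≢m = ν-indivisible {{prime⇒nonTrivial (q-prime m)}}
    (prime∤prime^ (q-prime m) (q-prime i) (i≢m ∘ q-injective ∘ sym) (e i))

≡+fromℤ⇒cross : ∀ s z x → s ≡ z ℚ.+ fromℤ x → ↥ s ℤ.* ↧ z ≡ (↥ z ℤ.+ x ℤ.* ↧ z) ℤ.* ↧ s
≡+fromℤ⇒cross s@(mkℚ _ _ _) z@(mkℚ _ _ _) x s≡z+x = begin
  ↥ s ℤ.* ↧ z                          ≡⟨ cong (λ d → ↥ s ℤ.* + d) (*-identityʳ (↧ₙ z)) ⟨
  ↥ s ℤ.* + (↧ₙ z * 1)                 ≡⟨ ℚᵘ.drop-*≡* s≃z+x ⟩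
  (↥ z ℤ.* + 1 ℤ.+ x ℤ.* ↧ z) ℤ.* ↧ s  ≡⟨ cong (λ n → (n ℤ.+ x ℤ.* ↧ z) ℤ.* ↧ s) (ℤ.*-identityʳ (↥ z)) ⟩
  (↥ z ℤ.+ x ℤ.* ↧ z) ℤ.* ↧ s          ∎
  where
  open ≡-Reasoning
  s≃z+x = ℚᵘ.≃-trans (ℚ.toℚᵘ-cong s≡z+x) (ℚ.toℚᵘ-homo-+ z (fromℤ x))

/≡+fromℤ⇒cross : ∀ i n .{{_ : NonZero n}} z x → i ℚ./ n ≡ z ℚ.+ fromℤ x →
                 i ℤ.* ↧ z ≡ (↥ z ℤ.+ x ℤ.* ↧ z) ℤ.* + n
/≡+fromℤ⇒cross i n z x i/n≡z+x = begin
  i ℤ.* ↧ z                    ≡⟨ cong (ℤ._* ↧ z) (ℚ.↥-/ i n) ⟨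
  ↥ s ℤ.* g ℤ.* ↧ z            ≡⟨ xy∙z≈xz∙y (↥ s) g (↧ z) ⟩
  ↥ s ℤ.* ↧ z ℤ.* g            ≡⟨ cong (ℤ._* g) (≡+fromℤ⇒cross s z x i/n≡z+x) ⟩
  M ℤ.* ↧ s ℤ.* g              ≡⟨ ℤ.*-assoc M (↧ s) g ⟩
  M ℤ.* (↧ s ℤ.* g)            ≡⟨ cong (M ℤ.*_) (ℚ.↧-/ i n) ⟩
  M ℤ.* + n                    ∎
  where
  open ≡-Reasoning
  s = i ℚ./ n
  g = gcd i (+ n)
  M = ↥ z ℤ.+ x ℤ.* ↧ z

-- a/b − p = N/D with N = q p² and p ∤ D gives a D = p (q p + D) b, where p ∤ q p + D.
ν-near-p : ∀ {p a b} → Prime p → .{{_ : NonZero a}} .{{_ : NonZero b}} →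
           ValAtLeast p 2 ((+ a) ℚ./ b ℚ.- fromℤ (+ p)) → ν p a ≡ suc (ν p b)
ν-near-p {p} {a} {b} p-prime (p²∣∣N∣ , p∤D) = ν-cross p-prime a*D≡p*∣Y∣*b p∤D p∤∣Y∣
  where
  open ≡-Reasoning
  s = (+ a) ℚ./ b
  z = s ℚ.- fromℤ (+ p)
  N = ↥ z
  D = ↧ₙ z
  open ℤ∣._∣_ (ℤ∣.∣ᵤ⇒∣ {+ (p ^ 2)} {N} p²∣∣N∣) renaming (quotient to q; equality to N≡q*p²)
  Y = q ℤ.* + p ℤ.+ + D

  N+p*D≡p*Y : N ℤ.+ + p ℤ.* + D ≡ + p ℤ.* Y
  N+p*D≡p*Y = trans (cong (λ n → n ℤ.+ + p ℤ.* + D) (trans N≡q*p² (cong (q ℤ.*_) p²≡p*p)))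
                    (factor-p q (+ p) (+ D))
    where
    p²≡p*p : + (p ^ 2) ≡ + p ℤ.* + p
    p²≡p*p = trans (cong (λ m → + (p * m)) (*-identityʳ p)) (ℤ.pos-* p p)
    factor-p : ∀ q P D → q ℤ.* (P ℤ.* P) ℤ.+ P ℤ.* D ≡ P ℤ.* (q ℤ.* P ℤ.+ D)
    factor-p = solve-∀

  a*D≡p*∣Y∣*b : a * D ≡ p * ℤ.∣ Y ∣ * b
  a*D≡p*∣Y∣*b = begin
    a * D                              ≡⟨ ℤ.abs-* (+ a) (+ D) ⟨
    ℤ.∣ + a ℤ.* + D ∣                  ≡⟨ cong ℤ.∣_∣ (/≡+fromℤ⇒cross (+ a) b z (+ p) s≡z+p) ⟩
    ℤ.∣ (N ℤ.+ + p ℤ.* + D) ℤ.* + b ∣  ≡⟨ cong (λ m → ℤ.∣ m ℤ.* + b ∣) N+p*D≡p*Y ⟩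
    ℤ.∣ + p ℤ.* Y ℤ.* + b ∣            ≡⟨ ℤ.abs-* (+ p ℤ.* Y) (+ b) ⟩
    ℤ.∣ + p ℤ.* Y ∣ * b                ≡⟨ cong (_* b) (ℤ.abs-* (+ p) Y) ⟩
    p * ℤ.∣ Y ∣ * b                    ∎
    where
    s≡z+p = sym (//-rightDividesˡ (fromℤ (+ p)) s)

  p∤∣Y∣ : ¬ p ∣ ℤ.∣ Y ∣
  p∤∣Y∣ p∣∣Y∣ = p∤D (ℤ∣.∣⇒∣ᵤ (ℤ∣.∣m+n∣m⇒∣n (ℤ∣.∣ᵤ⇒∣ p∣∣Y∣) p∣q*p))
    where
    p∣q*p = ℤ∣.∣n⇒∣m*n q ℤ∣.∣-refl

strictlyIncreasing⇒injective : ∀ {n} (f : Fin n → ℕ) → (∀ i j → i <ᶠ j → f i < f j) →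
                               Injective _≡_ _≡_ f
strictlyIncreasing⇒injective f f-increasing {i} {j} fi≡fj with Fin.<-cmp i j
... | tri< i<j _ _ = contradiction fi≡fj (<⇒≢ (f-increasing i j i<j))
... | tri≈ _ i≡j _ = i≡j
... | tri> _ _ j<i = contradiction (sym fi≡fj) (<⇒≢ (f-increasing j i j<i))

2^⌊log₂n⌋≤n : ∀ n .{{_ : NonZero n}} → 2 ^ ⌊log₂ n ⌋ ≤ n
2^⌊log₂n⌋≤n n = 2^⌊log2⌋≤n n (<-wellFounded n)
  where
  open ≤-Reasoning
  2^⌊log2⌋≤n : ∀ n .{{_ : NonZero n}} (rec : Acc _<_ n) → 2 ^ ⌊log2⌋ n rec ≤ n
  2^⌊log2⌋≤n 1             _        = ≤-refl
  2^⌊log2⌋≤n (suc (suc n)) (acc rs) = begin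
    2 * 2 ^ ⌊log2⌋ (suc ⌊ n /2⌋) _  ≤⟨ *-monoʳ-≤ 2 (2^⌊log2⌋≤n (suc ⌊ n /2⌋) _) ⟩
    2 * suc ⌊ n /2⌋                 ≡⟨ *-distribˡ-+ 2 1 ⌊ n /2⌋ ⟩
    2 + 2 * ⌊ n /2⌋                 ≤⟨ +-monoʳ-≤ 2 (2*⌊n/2⌋≤n n) ⟩
    2 + n                           ∎
    where
    2*⌊n/2⌋≤n : ∀ n → 2 * ⌊ n /2⌋ ≤ n
    2*⌊n/2⌋≤n n = begin
      ⌊ n /2⌋ + (⌊ n /2⌋ + 0)  ≡⟨ cong (_+_ ⌊ n /2⌋) (+-identityʳ ⌊ n /2⌋) ⟩
      ⌊ n /2⌋ + ⌊ n /2⌋        ≤⟨ +-monoʳ-≤ ⌊ n /2⌋ (⌊n/2⌋≤⌈n/2⌉ n) ⟩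
      ⌊ n /2⌋ + ⌈ n /2⌉        ≡⟨ ⌊n/2⌋+⌈n/2⌉≡n n ⟩
      n                        ∎

module _ {n : ℕ} .{{_ : NonZero n}} (r : Fin n) (h : ℕ) where

  toℕ+*-mod : (toℕ r + h * n) mod n ≡ r
  toℕ+*-mod = toℕ-injective (trans (toℕ-fromℕ< _)
    (trans ([m+kn]%n≡m%n (toℕ r) h n) (m<n⇒m%n≡m (toℕ<n r))))

  toℕ+*-div : (toℕ r + h * n) / n ≡ h
  toℕ+*-div = trans (+-distrib-/-∣ʳ (toℕ r) (n∣m*n h))
    (cong₂ _+_ (m<n⇒m/n≡0 (toℕ<n r)) (m*n/n≡m h n))

mod2-suc≢ : ∀ e → suc e mod 2 ≢ e mod 2
mod2-suc≢ zero          ()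
mod2-suc≢ (suc zero)    ()
mod2-suc≢ (suc (suc e)) = mod2-suc≢ e

funToFin-cong : ∀ {m n} {f g : Fin m → Fin n} → f ≗ g → funToFin f ≡ funToFin g
funToFin-cong {zero}  _   = refl
funToFin-cong {suc m} f≗g = cong₂ combine (f≗g zero) (funToFin-cong (f≗g ∘ suc))

module _ {L k : ℕ} .{{_ : NonZero L}} (L≤k : L ≤ k) where

  fromModDiv : Fin L → ℕ → Fin k
  fromModDiv r h with toℕ r + h * L <? k
  ... | yes r+h*L<k = fromℕ< r+h*L<k
  ... | no  _       = inject≤ r L≤k

  toℕ-fromModDiv : ∀ r h → ∃ λ h′ → toℕ (fromModDiv r h) ≡ toℕ r + h′ * L
  toℕ-fromModDiv r h with toℕ r + h * L <? k
  ... | yes r+h*L<k = h , toℕ-fromℕ< r+h*L<k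
  ... | no  _       = 0 , trans (toℕ-inject≤ r L≤k) (sym (+-identityʳ (toℕ r)))

  toℕ-fromModDiv-< : ∀ r h → toℕ r + h * L < k → toℕ (fromModDiv r h) ≡ toℕ r + h * L
  toℕ-fromModDiv-< r h r+h*L<k with toℕ r + h * L <? k
  ... | yes r+h*L<k = toℕ-fromℕ< r+h*L<k
  ... | no  r+h*L≮k = contradiction r+h*L<k r+h*L≮k

  fromModDiv-mod : ∀ r h → toℕ (fromModDiv r h) mod L ≡ r
  fromModDiv-mod r h with toℕ-fromModDiv r h
  ... | h′ , eq = trans (cong (_mod L) eq) (toℕ+*-mod r h′)

  fromModDiv-mod-div : ∀ j → fromModDiv (toℕ j mod L) (toℕ j / L) ≡ j
  fromModDiv-mod-div j = toℕ-injective
    (trans (toℕ-fromModDiv-< r h (subst (_< k) (sym r+h*L≡j) (toℕ<n j))) r+h*L≡j)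
    where
    r = toℕ j mod L
    h = toℕ j / L
    r+h*L≡j : toℕ r + h * L ≡ toℕ j
    r+h*L≡j = trans (cong (_+ h * L) (toℕ-fromℕ< _)) (sym (m≡m%n+[m/n]*n (toℕ j) L))

module Colouring {ℓ k : ℕ} (2^ℓ≤k : 2 ^ ℓ ≤ k) (ps : Fin ℓ → ℕ) (i₀ : Fin ℓ) where
  open ≡-Reasoning
  private instance
    2^ℓ≢0 : NonZero (2 ^ ℓ)
    2^ℓ≢0 = m^n≢0 2 ℓ

  parities : ℕ → Fin ℓ → Fin 2
  parities n i = ν (ps i) n mod 2

  colour : ℕ → Fin k
  colour n = fromModDiv 2^ℓ≤k (funToFin (parities n)) (ν (ps i₀) n / 2)

  colour-parities : ∀ {a b} → colour a ≡ colour b → parities a ≗ parities b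
  colour-parities {a} {b} ca≡cb i = begin
    parities a i                        ≡⟨ finToFun-funToFin (parities a) i ⟨
    finToFun (funToFin (parities a)) i  ≡⟨ cong (λ t → finToFun t i) funToFin-parities ⟩
    finToFun (funToFin (parities b)) i  ≡⟨ finToFun-funToFin (parities b) i ⟩
    parities b i                        ∎
    where
    funToFin-parities : funToFin (parities a) ≡ funToFin (parities b)
    funToFin-parities = trans (sym (fromModDiv-mod 2^ℓ≤k _ _))
      (trans (cong (λ c → toℕ c mod 2 ^ ℓ) ca≡cb) (fromModDiv-mod 2^ℓ≤k _ _))

  colour-not-dense : ∀ {i} j → Prime (ps i) → ¬ DenseIn (ps i) (RatioSet colour j)
  colour-not-dense {i} j p-prime dense with dense (fromℤ (+ ps i)) 2
  ... | _ , (a , b , ca≡j , cb≡j , refl) , close = mod2-suc≢ (ν (ps i) (suc b)) (begin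
    suc (ν (ps i) (suc b)) mod 2  ≡⟨ cong (_mod 2) (ν-near-p p-prime close) ⟨
    ν (ps i) (suc a) mod 2        ≡⟨ colour-parities {suc a} {suc b} (trans ca≡j (sym cb≡j)) i ⟩
    ν (ps i) (suc b) mod 2        ∎)

  colour-surjective : (∀ i → Prime (ps i)) → Injective _≡_ _≡_ ps →
                      ∀ j → ∃ λ n → colour (suc n) ≡ j
  colour-surjective ps-prime ps-injective j = pred W , (begin
    colour (suc (pred W))  ≡⟨ cong colour (suc-pred W {{W≢0}}) ⟩
    colour W               ≡⟨ cong₂ (fromModDiv 2^ℓ≤k) funToFin-parities half-ν-W ⟩
    fromModDiv 2^ℓ≤k r h   ≡⟨ fromModDiv-mod-div 2^ℓ≤k j ⟩
    j                      ∎)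
    where
    r = toℕ j mod 2 ^ ℓ
    h = toℕ j / 2 ^ ℓ
    digits = finToFun r
    e : Fin ℓ → ℕ
    e i = toℕ (digits i) + h * 2
    W = product (λ i → ps i ^ e i)
    W≢0 : NonZero W
    W≢0 = product≢0 _ (λ i → m^n≢0 (ps i) (e i) {{prime⇒nonZero (ps-prime i)}})
    ν-W : ∀ i → ν (ps i) W ≡ e i
    ν-W = ν-product-of-powers ps-prime ps-injective e
    parities-W : parities W ≗ digits
    parities-W i = trans (cong (_mod 2) (ν-W i)) (toℕ+*-mod (digits i) h)
    funToFin-parities : funToFin (parities W) ≡ r
    funToFin-parities = trans (funToFin-cong parities-W) (funToFin-finToFin {ℓ} {2} r)
    half-ν-W : ν (ps i₀) W / 2 ≡ h
    half-ν-W = trans (cong (_/ 2) (ν-W i₀)) (toℕ+*-div (digits i₀) h)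

theorem3p2 : (k : ℕ) → 2 ≤ k →
    (ps : Fin ⌊log₂ k ⌋ → ℕ) → (∀ i → Prime (ps i)) →
    (∀ i j → i <ᶠ j → ps i < ps j) →
    Σ (ℕ → Fin k) λ c →
      (∀ j → ∃ λ n → c (suc n) ≡ j) ×
      (∀ i j → ¬ DenseIn (ps i) (RatioSet c j))
theorem3p2 k 2≤k ps ps-prime ps-increasing =
  colour , colour-surjective ps-prime (strictlyIncreasing⇒injective ps ps-increasing) ,
  λ i j → colour-not-dense j (ps-prime i)
  where
  instance
    k≢0 : NonZero k
    k≢0 = >-nonZero (<-trans z<s 2≤k)
  ⌊log₂k⌋>0 : 0 < ⌊log₂ k ⌋
  ⌊log₂k⌋>0 = ⌊log₂⌋-mono-≤ 2≤k
  open Colouring (2^⌊log₂n⌋≤n k) ps (fromℕ< ⌊log₂k⌋>0)
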